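{- Let $k$ be a field, $A$ a commutative $k$-algebra, $\Xi:A\to A$ a $k$-linear map, and $\Psi$ the associated invariant. Then $\Psi$ distinguishes rooted forests if and only if $\Psi$ distinguishes rooted trees; that is, [$\Psi(S_1)=\Psi(S_2)\iff S_1\cong S_2$ for all rooted forests $S_1,S_2$] holds if and only if [$\Psi(T_1)=\Psi(T_2)\iff T_1\cong T_2$ for all rooted trees $T_1,T_2$] holds.
   Context: A rooted tree is a finite connected acyclic graph with a distinguished vertex (its root); a rooted forest is a finite disjoint union of rooted trees (its connected components); isomorphisms are root-preserving. In a rooted tree, a vertex $w$ is a child of $v$ if $v,w$ are joined by an edge and $w$ is farther from the root than $v$; a leaf is a vertex without children. The invariant $\Psi$ is defined as follows. For a rooted tree $T$, assign to each vertex $v$ an element $N_v\in A$ inductively starting from the vertices farthest from the root: if $v$ is a leaf, $N_v=\Xi(1)$; otherwise $N_v=\Xi(N_{v_1}\cdots N_{v_k})$ where $v_1,\dots,v_k$ are the distinct children of $v$. Set $\Psi(T)=N_{\mathrm{rt}_T}$. For a rooted forest $S$ with connected components $T_1,\dots,T_m$, set $\Psi(S)=\prod_{i=1}^m\Psi(T_i)$. -}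

module Defs where

open import Level using (Level; _⊔_; suc)
open import Algebra.Bundles using (CommutativeRing)
open import Algebra.Morphism.Structures using (module RingMorphisms)
open import Data.List using (List; []; _∷_; _++_)
open import Data.Product using (Σ; _×_)
open import Relation.Nullary using (¬_)
open import Function.Bundles using (_⇔_)

record Field (c ℓ : Level) : Set (suc (c ⊔ ℓ)) where
  field
    commutativeRing : CommutativeRing c ℓ
  open CommutativeRing commutativeRing public
  field
    0≉1     : ¬ (0# ≈ 1#)
    inverse : ∀ x → ¬ (x ≈ 0#) → Σ Carrier (λ y → (x * y) ≈ 1#)

record CommAlgebra {c ℓ : Level} (k : Field c ℓ) (a ℓa : Level)
       : Set (c ⊔ ℓ ⊔ suc (a ⊔ ℓa)) where
  private module K = Field k
  field
    commRing : CommutativeRing a ℓa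
  open CommutativeRing commRing public
  field
    ι        : K.Carrier → Carrier
    ι-isHom  : RingMorphisms.IsRingHomomorphism
                 (CommutativeRing.rawRing K.commutativeRing)
                 (CommutativeRing.rawRing commRing) ι

  _·_ : K.Carrier → Carrier → Carrier
  c · x = ι c * x

record LinearEndo {c ℓ a ℓa : Level} {k : Field c ℓ}
       (A : CommAlgebra k a ℓa) : Set (c ⊔ a ⊔ ℓa) where
  open CommAlgebra A
  field
    map      : Carrier → Carrier
    map-cong : ∀ {x y} → x ≈ y → map x ≈ map y
    map-+    : ∀ x y → map (x + y) ≈ (map x + map y)
    map-·    : ∀ c x → map (c · x) ≈ (c · map x)

-- A rooted tree is its root together with the (finite) multiset of
-- subtrees hanging from the root's children; a forest is a finite
-- collection of rooted trees (its connected components).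

data Tree : Set where
  node : List Tree → Tree

Forest : Set
Forest = List Tree

-- Root-preserving isomorphism of rooted trees, and isomorphism of
-- rooted forests (a bijection between components matching them up to
-- tree isomorphism).
mutual
  data _≅ᵗ_ : Tree → Tree → Set where
    node : ∀ {ts us} → ts ≅ᶠ us → node ts ≅ᵗ node us

  data _≅ᶠ_ : Forest → Forest → Set where
    []  : [] ≅ᶠ []
    _∷_ : ∀ {t u ts us₁ us₂} → t ≅ᵗ u → ts ≅ᶠ (us₁ ++ us₂)
          → (t ∷ ts) ≅ᶠ (us₁ ++ u ∷ us₂)

module Invariant {c ℓ a ℓa : Level} {k : Field c ℓ}
                 (A : CommAlgebra k a ℓa) (Ξ : LinearEndo A) where
  open CommAlgebra A
  open LinearEndo Ξ renaming (map to Ξ′)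

  mutual
    Ψᵗ : Tree → Carrier
    Ψᵗ (node ts) = Ξ′ (Ψᶠ ts)

    Ψᶠ : Forest → Carrier
    Ψᶠ []       = 1#
    Ψᶠ (t ∷ ts) = Ψᵗ t * Ψᶠ ts

  DistinguishesTrees : Set ℓa
  DistinguishesTrees = ∀ (T₁ T₂ : Tree) → (Ψᵗ T₁ ≈ Ψᵗ T₂) ⇔ (T₁ ≅ᵗ T₂)

  DistinguishesForests : Set ℓa
  DistinguishesForests = ∀ (S₁ S₂ : Forest) → (Ψᶠ S₁ ≈ Ψᶠ S₂) ⇔ (S₁ ≅ᶠ S₂)

-- A forest S is recovered, up to isomorphism, from the tree obtained by
-- grafting its components onto a new root, and Ψ of that tree is Ξ(Ψ S);
-- conversely a tree T is a one-component forest, whose Ψ is Ψ T · 1. So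
-- injectivity of Ψ on either kind of object transfers to the other. The
-- remaining implication, invariance of Ψ under isomorphism, holds for any
-- Ξ because A is commutative.

module Submission where

open import Defs
open import Level using (Level)
open import Function.Bundles using (_⇔_; mk⇔; Equivalence)
open import Data.List using ([]; _∷_; _++_)
open import Relation.Binary.PropositionalEquality using (_≡_) renaming (refl to ≡-refl)
import Algebra.Properties.CommutativeSemigroup as CommSemigroupProperties

node-injective : ∀ {ts us} → node ts ≅ᵗ node us → ts ≅ᶠ us
node-injective (node p) = p

≅ᵗ⇒singleton-≅ᶠ : ∀ {t u} → t ≅ᵗ u → (t ∷ []) ≅ᶠ (u ∷ [])
≅ᵗ⇒singleton-≅ᶠ p = _∷_ {us₁ = []} p []

singleton-≅ᶠ⇒≅ᵗ : ∀ {t u xs} → (t ∷ []) ≅ᶠ xs → xs ≡ u ∷ [] → t ≅ᵗ u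
singleton-≅ᶠ⇒≅ᵗ (_∷_ {us₁ = []}    p _)  ≡-refl = p
singleton-≅ᶠ⇒≅ᵗ (_∷_ {us₁ = _ ∷ _} _ ()) _

module _ {c ℓ a ℓa : Level} {k : Field c ℓ} (A : CommAlgebra k a ℓa)
         (Ξ : LinearEndo A) where
  open CommAlgebra A
  open LinearEndo Ξ using (map-cong)
  open Invariant A Ξ
  open CommSemigroupProperties *-commutativeSemigroup using (x∙yz≈y∙xz)

  Ψᶠ-insert : ∀ u us₁ us₂ → Ψᶠ (us₁ ++ u ∷ us₂) ≈ Ψᵗ u * Ψᶠ (us₁ ++ us₂)
  Ψᶠ-insert u []        us₂ = refl
  Ψᶠ-insert u (v ∷ us₁) us₂ =
    trans (*-cong refl (Ψᶠ-insert u us₁ us₂)) (x∙yz≈y∙xz (Ψᵗ v) (Ψᵗ u) _)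

  mutual
    Ψᵗ-resp-≅ᵗ : ∀ {t u} → t ≅ᵗ u → Ψᵗ t ≈ Ψᵗ u
    Ψᵗ-resp-≅ᵗ (node p) = map-cong (Ψᶠ-resp-≅ᶠ p)

    Ψᶠ-resp-≅ᶠ : ∀ {ts us} → ts ≅ᶠ us → Ψᶠ ts ≈ Ψᶠ us
    Ψᶠ-resp-≅ᶠ [] = refl
    Ψᶠ-resp-≅ᶠ (_∷_ {u = u} {us₁ = us₁} {us₂ = us₂} p q) =
      trans (*-cong (Ψᵗ-resp-≅ᵗ p) (Ψᶠ-resp-≅ᶠ q)) (sym (Ψᶠ-insert u us₁ us₂))

  distinguishesForests⇒distinguishesTrees : DistinguishesForests → DistinguishesTrees
  distinguishesForests⇒distinguishesTrees distinguishes T₁ T₂ = mk⇔ injective Ψᵗ-resp-≅ᵗ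
    where
    injective : Ψᵗ T₁ ≈ Ψᵗ T₂ → T₁ ≅ᵗ T₂
    injective e = singleton-≅ᶠ⇒≅ᵗ
      (Equivalence.to (distinguishes (T₁ ∷ []) (T₂ ∷ [])) (*-cong e refl)) ≡-refl

  distinguishesTrees⇒distinguishesForests : DistinguishesTrees → DistinguishesForests
  distinguishesTrees⇒distinguishesForests distinguishes S₁ S₂ = mk⇔ injective Ψᶠ-resp-≅ᶠ
    where
    injective : Ψᶠ S₁ ≈ Ψᶠ S₂ → S₁ ≅ᶠ S₂
    injective e = node-injective
      (Equivalence.to (distinguishes (node S₁) (node S₂)) (map-cong e))

proposition4p2 : ∀ {c ℓ a ℓa : Level} (k : Field c ℓ) (A : CommAlgebra k a ℓa)
    (Ξ : LinearEndo A) →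
    Invariant.DistinguishesForests A Ξ ⇔ Invariant.DistinguishesTrees A Ξ
proposition4p2 k A Ξ = mk⇔ (distinguishesForests⇒distinguishesTrees A Ξ)
                           (distinguishesTrees⇒distinguishesForests A Ξ)
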